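{- Let $H$ be a crown-free linear $3$-graph with $n$ vertices such that $H$ has no edge $e$ with $D(e) \geq (4,4,3)$ and no edge $e$ with $D(e) \geq (5,4,2)$. Then $|E(H)| \leq \frac{3n}{2}$.
   Context: A (linear) $3$-graph $H=(V,E)$ consists of a finite vertex set $V$ and a set $E$ of $3$-element subsets of $V$ (edges) such that any two distinct edges intersect in at most one vertex; $d(v)$ denotes the number of edges containing $v$. A crown is the $3$-graph consisting of three pairwise disjoint edges together with a fourth edge intersecting each of them; $H$ is crown-free if no four edges of $H$ form a crown. For an edge $e=\{a,b,c\}$, $D(e)$ is the vector $(d(a),d(b),d(c))$ with coordinates arranged in non-increasing order. For two such vectors, $D(e) \geq (x,y,z)$ means coordinatewise: the first coordinate of $D(e)$ is at least $x$, the second at least $y$, and the third at least $z$. -}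

module Defs where

open import Data.Nat using (ℕ; _⊔_; _⊓_; _≤_)
open import Data.Fin using (Fin; _≟_)
open import Data.Fin.Properties using ()
open import Data.List using (List; length; filter; lookup)
open import Data.Product using (_×_; _,_; Σ; ∃; ∃-syntax)
open import Data.Sum using (_⊎_)
open import Relation.Nullary using (¬_; Dec; yes; no)
open import Relation.Nullary.Decidable using (_⊎-dec_)
open import Relation.Binary.PropositionalEquality using (_≡_)

record Triple (n : ℕ) : Set where
  constructor triple
  field
    a b c : Fin n
    a≢b : ¬ a ≡ b
    a≢c : ¬ a ≡ c
    b≢c : ¬ b ≡ c

open Triple public

_∈ₑ_ : ∀ {n} → Fin n → Triple n → Set
v ∈ₑ e = v ≡ a e ⊎ v ≡ b e ⊎ v ≡ c e

_∈ₑ?_ : ∀ {n} (v : Fin n) (e : Triple n) → Dec (v ∈ₑ e)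
v ∈ₑ? e = (v ≟ a e) ⊎-dec ((v ≟ b e) ⊎-dec (v ≟ c e))

-- Distinct positions in the list are distinct edges (enforced by linearity below,
-- since two equal 3-sets share 3 vertices).
record Graph3 (n : ℕ) : Set where
  constructor graph3
  field
    edges : List (Triple n)

open Graph3 public

Edge : ∀ {n} → Graph3 n → Set
Edge H = Fin (length (edges H))

edge : ∀ {n} (H : Graph3 n) → Edge H → Triple n
edge H i = lookup (edges H) i

numEdges : ∀ {n} → Graph3 n → ℕ
numEdges H = length (edges H)

deg : ∀ {n} → Graph3 n → Fin n → ℕ
deg H v = length (filter (v ∈ₑ?_) (edges H))

-- Linear: any two distinct edges intersect in at most one vertex
-- (this also forces the list to have no repeated 3-set).
Linear : ∀ {n} → Graph3 n → Set
Linear {n} H = ∀ (i j : Edge H) → ¬ i ≡ j → ∀ (u v : Fin n) →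
  u ∈ₑ edge H i → u ∈ₑ edge H j → v ∈ₑ edge H i → v ∈ₑ edge H j → u ≡ v

Disjoint : ∀ {n} → Triple n → Triple n → Set
Disjoint {n} e f = ∀ (v : Fin n) → v ∈ₑ e → ¬ v ∈ₑ f

Meets : ∀ {n} → Triple n → Triple n → Set
Meets {n} e f = ∃[ v ] (v ∈ₑ e × v ∈ₑ f)

-- A crown in H: edges e0,e1,e2,e3 of H with e1,e2,e3 pairwise disjoint and
-- e0 intersecting each of them (e0 is then automatically distinct from them,
-- as it meets all three of the pairwise disjoint edges).
IsCrown : ∀ {n} (H : Graph3 n) → Edge H → Edge H → Edge H → Edge H → Set
IsCrown H i₀ i₁ i₂ i₃ =
  Disjoint (edge H i₁) (edge H i₂) × Disjoint (edge H i₁) (edge H i₃) ×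
  Disjoint (edge H i₂) (edge H i₃) ×
  Meets (edge H i₀) (edge H i₁) × Meets (edge H i₀) (edge H i₂) ×
  Meets (edge H i₀) (edge H i₃)

CrownFree : ∀ {n} → Graph3 n → Set
CrownFree H = ∀ i₀ i₁ i₂ i₃ → ¬ IsCrown H i₀ i₁ i₂ i₃

-- sorting a triple of naturals into non-increasing order
sort3 : ℕ → ℕ → ℕ → ℕ × ℕ × ℕ
sort3 x y z = (x ⊔ y ⊔ z) , ((x ⊓ y) ⊔ (y ⊓ z) ⊔ (x ⊓ z)) , (x ⊓ y ⊓ z)

D : ∀ {n} (H : Graph3 n) → Triple n → ℕ × ℕ × ℕ
D H e = sort3 (deg H (a e)) (deg H (b e)) (deg H (c e))

_≥₃_ : ℕ × ℕ × ℕ → ℕ × ℕ × ℕ → Set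
(p₁ , p₂ , p₃) ≥₃ (q₁ , q₂ , q₃) = q₁ ≤ p₁ × q₂ ≤ p₂ × q₃ ≤ p₃

{-# OPTIONS --safe #-}
-- Discharging: every vertex of degree d hands 12/d to each of its edges (nothing
-- if d ≥ 5), so it gives away at most 12 in total.  The two forbidden degree
-- patterns are exactly what guarantees that every edge receives at least 8, hence
-- 8|E| ≤ 12n.
module Submission where

open import Defs
open import Data.Bool using (true; false; if_then_else_)
open import Data.Fin using (Fin; zero; suc; toℕ; _≟_)
open import Data.Fin.Patterns using (0F; 1F; 2F; 3F; 4F; 5F)
open import Data.Fin.Properties using (all?)
open import Data.List using ([]; _∷_)
open import Data.Nat using (ℕ; zero; suc; _+_; _*_; _≤_; _≤?_; z≤n)
open import Data.Nat.Properties
  using (+-*-semiring; +-mono-≤; +-identityʳ; *-zeroʳ; *-comm; *-assoc; *-cancelˡ-≤;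
         ≤-refl; ≤-trans; m≤m+n; ⊔-mono-≤; ⊓-mono-≤; module ≤-Reasoning)
open import Data.Product using (_×_; _,_)
open import Relation.Nullary using (¬_; Dec; does; yes; no; contradiction)
open import Relation.Nullary.Decidable using (_×-dec_; ¬?; _→-dec_; from-yes)
open import Relation.Binary.PropositionalEquality
  using (_≡_; refl; sym; trans; cong; cong₂; subst; module ≡-Reasoning)
open import Algebra.Properties.Semiring.Sum +-*-semiring
  using (sum; sum-syntax; sum-cong-≗; sum-replicate-zero; ∑-distrib-+; ∑-comm; *-distribʳ-sum)

∑-mono-≤ : ∀ {n} {f g : Fin n → ℕ} → (∀ i → f i ≤ g i) → sum f ≤ sum g
∑-mono-≤ {zero}  f≤g = z≤n
∑-mono-≤ {suc n} f≤g = +-mono-≤ (f≤g zero) (∑-mono-≤ (λ i → f≤g (suc i)))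

∑-const : ∀ n c → ∑[ i < n ] c ≡ n * c
∑-const zero    c = refl
∑-const (suc n) c = cong (c +_) (∑-const n c)

onlyAt : ∀ {n} → Fin n → (Fin n → ℕ) → Fin n → ℕ
onlyAt u g v = if does (v ≟ u) then g v else 0

∑-onlyAt : ∀ {n} (u : Fin n) (g : Fin n → ℕ) → ∑[ v < n ] onlyAt u g v ≡ g u
∑-onlyAt {suc n} zero    g = trans (cong (g zero +_) (sum-replicate-zero n)) (+-identityʳ (g zero))
∑-onlyAt {suc n} (suc u) g = ∑-onlyAt u (λ v → g (suc v))

incidence : ∀ {n} → Triple n → Fin n → ℕ
incidence e v = if does (v ∈ₑ? e) then 1 else 0

edgeSum : ∀ {n} → (Fin n → ℕ) → Triple n → ℕ
edgeSum g e = g (a e) + g (b e) + g (c e)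

incidence-*-split : ∀ {n} (e : Triple n) (g : Fin n → ℕ) v →
  incidence e v * g v ≡ onlyAt (a e) g v + onlyAt (b e) g v + onlyAt (c e) g v
incidence-*-split (triple a b c a≢b a≢c b≢c) g v with v ≟ a | v ≟ b | v ≟ c
... | yes refl | yes refl | _        = contradiction refl a≢b
... | yes refl | _        | yes refl = contradiction refl a≢c
... | _        | yes refl | yes refl = contradiction refl b≢c
... | yes _    | no _     | no _     = sym (+-identityʳ _)
... | no _     | yes _    | no _     = refl
... | no _     | no _     | yes _    = +-identityʳ _
... | no _     | no _     | no _     = refl

∑-incidence-* : ∀ {n} (e : Triple n) (g : Fin n → ℕ) →
  ∑[ v < n ] (incidence e v * g v) ≡ edgeSum g e
∑-incidence-* {n} e g = begin
  ∑[ v < n ] (incidence e v * g v)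
    ≡⟨ sum-cong-≗ (incidence-*-split e g) ⟩
  ∑[ v < n ] (onlyAt (a e) g v + onlyAt (b e) g v + onlyAt (c e) g v)
    ≡⟨ ∑-distrib-+ _ (onlyAt (c e) g) ⟩
  ∑[ v < n ] (onlyAt (a e) g v + onlyAt (b e) g v) + ∑[ v < n ] onlyAt (c e) g v
    ≡⟨ cong (_+ ∑[ v < n ] onlyAt (c e) g v) (∑-distrib-+ (onlyAt (a e) g) (onlyAt (b e) g)) ⟩
  ∑[ v < n ] onlyAt (a e) g v + ∑[ v < n ] onlyAt (b e) g v + ∑[ v < n ] onlyAt (c e) g v
    ≡⟨ cong₂ _+_ (cong₂ _+_ (∑-onlyAt (a e) g) (∑-onlyAt (b e) g)) (∑-onlyAt (c e) g) ⟩
  edgeSum g e ∎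
  where open ≡-Reasoning

deg≡∑-incidence : ∀ {n} (H : Graph3 n) v →
  deg H v ≡ ∑[ i < numEdges H ] incidence (edge H i) v
deg≡∑-incidence (graph3 [])      v = refl
deg≡∑-incidence (graph3 (e ∷ L)) v with does (v ∈ₑ? e)
... | true  = cong suc (deg≡∑-incidence (graph3 L) v)
... | false = deg≡∑-incidence (graph3 L) v

∑-deg-*≡∑-edgeSum : ∀ {n} (H : Graph3 n) (g : Fin n → ℕ) →
  ∑[ v < n ] (deg H v * g v) ≡ ∑[ i < numEdges H ] edgeSum g (edge H i)
∑-deg-*≡∑-edgeSum {n} H g = begin
  ∑[ v < n ] (deg H v * g v)
    ≡⟨ sum-cong-≗ (λ v → cong (_* g v) (deg≡∑-incidence H v)) ⟩
  ∑[ v < n ] ((∑[ i < m ] incidence (edge H i) v) * g v)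
    ≡⟨ sum-cong-≗ (λ v → *-distribʳ-sum (g v) (λ i → incidence (edge H i) v)) ⟩
  ∑[ v < n ] ∑[ i < m ] (incidence (edge H i) v * g v)
    ≡⟨ ∑-comm (λ v i → incidence (edge H i) v * g v) ⟩
  ∑[ i < m ] ∑[ v < n ] (incidence (edge H i) v * g v)
    ≡⟨ sum-cong-≗ (λ i → ∑-incidence-* (edge H i) g) ⟩
  ∑[ i < m ] edgeSum g (edge H i) ∎
  where
  open ≡-Reasoning
  m = numEdges H

-- Degree 0 never occurs on an edge; share 0 = 12 only spares shareBound a
-- positivity hypothesis.
share : ℕ → ℕ
share 0 = 12
share 1 = 12
share 2 = 6
share 3 = 4
share 4 = 3
share (suc (suc (suc (suc (suc _))))) = 0

deg-*-share≤12 : ∀ d → d * share d ≤ 12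
deg-*-share≤12 0 = z≤n
deg-*-share≤12 1 = ≤-refl
deg-*-share≤12 2 = ≤-refl
deg-*-share≤12 3 = ≤-refl
deg-*-share≤12 4 = ≤-refl
deg-*-share≤12 (suc (suc (suc (suc (suc d))))) = subst (_≤ 12) (sym (*-zeroʳ (5 + d))) z≤n

Admissible : ℕ × ℕ × ℕ → Set
Admissible p = ¬ (p ≥₃ (4 , 4 , 3)) × ¬ (p ≥₃ (5 , 4 , 2))

_≥₃?_ : ∀ p q → Dec (p ≥₃ q)
(p₁ , p₂ , p₃) ≥₃? (q₁ , q₂ , q₃) = q₁ ≤? p₁ ×-dec (q₂ ≤? p₂ ×-dec q₃ ≤? p₃)

admissible? : ∀ p → Dec (Admissible p)
admissible? p = ¬? (p ≥₃? (4 , 4 , 3)) ×-dec ¬? (p ≥₃? (5 , 4 , 2))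

≥₃-trans : ∀ {p q r} → p ≥₃ q → q ≥₃ r → p ≥₃ r
≥₃-trans {_ , _ , _} {_ , _ , _} {_ , _ , _} (q₁≤p₁ , q₂≤p₂ , q₃≤p₃) (r₁≤q₁ , r₂≤q₂ , r₃≤q₃) =
  ≤-trans r₁≤q₁ q₁≤p₁ , ≤-trans r₂≤q₂ q₂≤p₂ , ≤-trans r₃≤q₃ q₃≤p₃

admissible-≥₃ : ∀ {p q} → p ≥₃ q → Admissible p → Admissible q
admissible-≥₃ p≥q (no443 , no542) = (λ q≥ → no443 (≥₃-trans p≥q q≥)) , (λ q≥ → no542 (≥₃-trans p≥q q≥))

sort3-mono-≤ : ∀ {x y z x′ y′ z′} → x ≤ x′ → y ≤ y′ → z ≤ z′ → sort3 x′ y′ z′ ≥₃ sort3 x y z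
sort3-mono-≤ x≤ y≤ z≤ =
  ⊔-mono-≤ (⊔-mono-≤ x≤ y≤) z≤ ,
  ⊔-mono-≤ (⊔-mono-≤ (⊓-mono-≤ x≤ y≤) (⊓-mono-≤ y≤ z≤)) (⊓-mono-≤ x≤ z≤) ,
  ⊓-mono-≤ (⊓-mono-≤ x≤ y≤) z≤

-- Neither share nor the thresholds of Admissible distinguish degrees ≥ 5, so
-- capping at 5 reduces the edge bound to a finite check.
cap : ℕ → Fin 6
cap 0 = 0F
cap 1 = 1F
cap 2 = 2F
cap 3 = 3F
cap 4 = 4F
cap (suc (suc (suc (suc (suc _))))) = 5F

toℕ-cap≤ : ∀ d → toℕ (cap d) ≤ d
toℕ-cap≤ 0 = ≤-refl
toℕ-cap≤ 1 = ≤-refl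
toℕ-cap≤ 2 = ≤-refl
toℕ-cap≤ 3 = ≤-refl
toℕ-cap≤ 4 = ≤-refl
toℕ-cap≤ (suc (suc (suc (suc (suc d))))) = m≤m+n 5 d

share-cap : ∀ d → share (toℕ (cap d)) ≡ share d
share-cap 0 = refl
share-cap 1 = refl
share-cap 2 = refl
share-cap 3 = refl
share-cap 4 = refl
share-cap (suc (suc (suc (suc (suc d))))) = refl

ShareBound : ℕ → ℕ → ℕ → Set
ShareBound x y z = Admissible (sort3 x y z) → 8 ≤ share x + share y + share z

shareBound? : ∀ x y z → Dec (ShareBound x y z)
shareBound? x y z = admissible? (sort3 x y z) →-dec (8 ≤? share x + share y + share z)

shareBound-Fin6 : ∀ (x y z : Fin 6) → ShareBound (toℕ x) (toℕ y) (toℕ z)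
shareBound-Fin6 = from-yes (all? λ (x : Fin 6) → all? λ (y : Fin 6) → all? λ (z : Fin 6) →
  shareBound? (toℕ x) (toℕ y) (toℕ z))

shareBound : ∀ x y z → ShareBound x y z
shareBound x y z adm = subst (8 ≤_) capped-sum
  (shareBound-Fin6 (cap x) (cap y) (cap z)
    (admissible-≥₃ (sort3-mono-≤ (toℕ-cap≤ x) (toℕ-cap≤ y) (toℕ-cap≤ z)) adm))
  where
  capped-sum : share (toℕ (cap x)) + share (toℕ (cap y)) + share (toℕ (cap z)) ≡ share x + share y + share z
  capped-sum = cong₂ _+_ (cong₂ _+_ (share-cap x) (share-cap y)) (share-cap z)

theorem2 : ∀ (n : ℕ) (H : Graph3 n) → Linear H → CrownFree H →
    (∀ (i : Edge H) → ¬ (D H (edge H i) ≥₃ (4 , 4 , 3))) →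
    (∀ (i : Edge H) → ¬ (D H (edge H i) ≥₃ (5 , 4 , 2))) →
    2 * numEdges H ≤ 3 * n
theorem2 n H _ _ no443 no542 = *-cancelˡ-≤ 4 (begin
  4 * (2 * m)                             ≡⟨ sym (*-assoc 4 2 m) ⟩
  8 * m                                   ≡⟨ *-comm 8 m ⟩
  m * 8                                   ≡⟨ sym (∑-const m 8) ⟩
  ∑[ i < m ] 8                            ≤⟨ ∑-mono-≤ (λ i → shareBound _ _ _ (no443 i , no542 i)) ⟩
  ∑[ i < m ] edgeSum g (edge H i)         ≡⟨ sym (∑-deg-*≡∑-edgeSum H g) ⟩
  ∑[ v < n ] (deg H v * share (deg H v))  ≤⟨ ∑-mono-≤ (λ v → deg-*-share≤12 (deg H v)) ⟩
  ∑[ v < n ] 12                           ≡⟨ ∑-const n 12 ⟩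
  n * 12                                  ≡⟨ *-comm n 12 ⟩
  12 * n                                  ≡⟨ *-assoc 4 3 n ⟩
  4 * (3 * n)                             ∎)
  where
  open ≤-Reasoning
  m = numEdges H
  g : Fin n → ℕ
  g v = share (deg H v)
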